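{- For integers $a_1,a_2\ge1$, \[ G(a_1,a_2,0)=G(a_1-1,a_2,0)+G(a_1,a_2-1,0)+(-1)^{a_1+a_2}. \]
   Context: For a sequence $\mathbf c=(c_1,\dots,c_r)$ of nonnegative integers with sum $N$, blocks are the consecutive intervals of $[N]$ of lengths $c_1,\dots,c_r$, and $S_{\mathbf c}$ is the set of permutations $\pi$ of $[N]$ with $\pi_i>\pi_{i+1}$ whenever $i,i+1$ are in the same block. For nonnegative integers $a_1,a_2,s$, $G(a_1,a_2,s)$ is the sum, over all integers $m$ for which all parts are nonnegative, of the number of permutations in $S_{(a_1-m,\;a_2-(s-m),\;m,\;s-m)}$ having no fixed point ($\pi_i=i$) in the first two blocks. In particular $G(a_1,a_2,0)$ is the number of $\pi\in S_{(a_1,a_2)}$ with no fixed points. -}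

module Defs where

open import Data.Nat using (ℕ; zero; suc; _+_; _∸_; _≡ᵇ_; _<ᵇ_; _≤ᵇ_)
open import Data.Bool using (Bool; true; false; _∧_; not; if_then_else_)
open import Data.List using (List; []; _∷_; map; concatMap; replicate; concat; length; filter; upTo; foldr)
open import Data.Nat.ListAction using (sum)
open import Relation.Nullary using (Dec; yes; no)
open import Relation.Binary.PropositionalEquality using (_≡_; refl)

range1 : ℕ → List ℕ
range1 k = map suc (upTo k)

words : ℕ → ℕ → List (List ℕ)
words k zero    = [] ∷ []
words k (suc n) = concatMap (λ x → map (x ∷_) (words k n)) (range1 k)

elemᵇ : ℕ → List ℕ → Bool
elemᵇ x []       = false
elemᵇ x (y ∷ ys) = (x ≡ᵇ y) Data.Bool.∨ elemᵇ x ys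

distinct : List ℕ → Bool
distinct []       = true
distinct (x ∷ xs) = not (elemᵇ x xs) ∧ distinct xs

-- all permutations of [N] = {1,…,N}, in one-line notation (π₁,…,π_N)
perms : ℕ → List (List ℕ)
perms N = filter (λ w → distinct w Data.Bool.≟ true) (words N N)

-- block label of each position 1..N for composition c = (c₁,…,c_r): label j-1 for block j
labels : List ℕ → List ℕ
labels c = go 0 c
  where
  go : ℕ → List ℕ → List ℕ
  go j []       = []
  go j (k ∷ ks) = replicate k j Data.List.++ go (suc j) ks

descOK : List ℕ → List ℕ → Bool
descOK (l₁ ∷ l₂ ∷ ls) (p₁ ∷ p₂ ∷ ps) =
  (if l₁ ≡ᵇ l₂ then p₂ <ᵇ p₁ else true) ∧ descOK (l₂ ∷ ls) (p₂ ∷ ps)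
descOK _ _ = true

noFixFirstTwo : ℕ → List ℕ → List ℕ → Bool
noFixFirstTwo i (l ∷ ls) (p ∷ ps) =
  (if l <ᵇ 2 then not (p ≡ᵇ i) else true) ∧ noFixFirstTwo (suc i) ls ps
noFixFirstTwo _ _ _ = true

Sc : List ℕ → List (List ℕ)
Sc c = filter (λ π → descOK (labels c) π Data.Bool.≟ true) (perms (sum c))

countNoFix : List ℕ → ℕ
countNoFix c = length (filter (λ π → noFixFirstTwo 1 (labels c) π Data.Bool.≟ true) (Sc c))

-- G(a₁,a₂,s) = Σ_m #{π ∈ S_(a₁-m, a₂-(s-m), m, s-m) : no fixed point in first two blocks},
-- over all m with 0 ≤ m ≤ a₁, m ≤ s, s-m ≤ a₂ (all parts nonnegative)
G : ℕ → ℕ → ℕ → ℕ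
G a₁ a₂ s = sum (map term (upTo (suc a₁)))
  where
  term : ℕ → ℕ
  term m = if (m ≤ᵇ s) ∧ ((s ∸ m) ≤ᵇ a₂)
           then countNoFix ((a₁ ∸ m) ∷ (a₂ ∸ (s ∸ m)) ∷ m ∷ (s ∸ m) ∷ [])
           else 0

module Submission where

-- A permutation of [N], N = a₁ + a₂, decreasing on the blocks {1,…,a₁} and {a₁+1,…,N} is determined by
-- the set of values in the first block.  Building it by placing the values N, N-1, …, 1 one at a time
-- into the next free position of either block gives a recursive count `fixCount` that also records
-- whether each block has acquired a fixed point.  The enumeration of words in
--     Defs becomes a sum over pairs of disjoint decreasing words, and removing the largest letter of the
--     alphabet reproduces the recursion of fixCount;
--   * `four-classes`: sorting all placements by the blocks that contain a fixed point, and deleting that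
--     fixed point (`removal₁`, `removal₂`), the array D with D(i+1,j+1) = G(i,j,0) and D = 0 on the axes
--     has 2×2 block sums D i j + D i (j+1) + D (i+1) j + D (i+1) (j+1) = (i+j choose i).
-- The module `AlternatingRecurrence` shows that any array vanishing on the axes whose 2×2 block sums obey
-- Pascal's rule with boundary value 1 satisfies H(i+1,j+1) = H(i,j+1) + H(i+1,j) + (-1)^(i+j); the theorem
-- is the instance H = D.

open import Defs

module Placements where

  open import Algebra.Bundles using (CommutativeMonoid)
  import Algebra.Properties.CommutativeSemigroup as CommSemigroupProperties
  open import Data.Bool using (Bool; true; false; _∧_; _∨_; not)
  import Data.Bool as Bool
  open import Data.Bool.Properties
    using (∧-assoc; ∧-comm; ∧-zeroʳ; ∨-assoc; ∨-zeroʳ; ∨-identityʳ; ∧-commutativeMonoid; ¬-not; T-≡)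
  open import Data.List
    using (List; []; _∷_; _++_; map; length; filter; upTo; applyUpTo; concatMap; replicate)
  open import Data.List.Properties using (map-++; upTo-∷ʳ)
  open import Data.List.Relation.Unary.All as All using (All; []; _∷_)
  open import Data.List.Relation.Unary.All.Properties using (map⁺; all-upTo)
  open import Data.Nat
    using (ℕ; zero; suc; _+_; _*_; _≤_; _<_; z≤n; s≤s; z<s; s<s; s<s⁻¹; _≡ᵇ_; _<ᵇ_)
  open import Data.Nat.ListAction using (sum)
  open import Data.Nat.Properties
  open import Data.Nat.Tactic.RingSolver using (solve-∀)
  open import Data.Sum using (inj₁; inj₂)
  open import Function using (Equivalence)
  open import Relation.Binary.PropositionalEquality
  open import Relation.Nullary using (¬_)

  open CommSemigroupProperties +-commutativeSemigroup using (interchange)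
  open CommSemigroupProperties *-commutativeSemigroup using () renaming (x∙yz≈y∙xz to *-swap)
  open CommSemigroupProperties (CommutativeMonoid.commutativeSemigroup ∧-commutativeMonoid)
    using () renaming (x∙yz≈y∙xz to ∧-swap)

  𝟙 : Bool → ℕ
  𝟙 true  = 1
  𝟙 false = 0

  𝟙-∧ : ∀ a b → 𝟙 (a ∧ b) ≡ 𝟙 a * 𝟙 b
  𝟙-∧ true  b = sym (*-identityˡ (𝟙 b))
  𝟙-∧ false b = refl

  _==_ : Bool → Bool → Bool
  true  == b = b
  false == b = not b

  ≡ᵇ-refl : ∀ n → (n ≡ᵇ n) ≡ true
  ≡ᵇ-refl n = Equivalence.to T-≡ (≡⇒≡ᵇ n n refl)

  ≡ᵇ-false : ∀ {m n} → ¬ m ≡ n → (m ≡ᵇ n) ≡ false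
  ≡ᵇ-false {m} {n} m≢n = ¬-not (λ m≡ᵇn → m≢n (≡ᵇ⇒≡ m n (Equivalence.from T-≡ m≡ᵇn)))

  -- The fixed-point flag s of a block after the value v has been put at position p.
  mark : Bool → ℕ → ℕ → Bool
  mark s v p = s ∨ (v ≡ᵇ p)

  mark-hit : ∀ s v → mark s v v ≡ true
  mark-hit s v = trans (cong (s ∨_) (≡ᵇ-refl v)) (∨-zeroʳ s)

  mark-miss : ∀ s {v p} → ¬ v ≡ p → mark s v p ≡ s
  mark-miss s v≢p = trans (cong (s ∨_) (≡ᵇ-false v≢p)) (∨-identityʳ s)

  -- The values N, N-1, …, 1 (N = m₁ + m₂) are distributed, largest first, into two blocks
  -- filled from left to right, so that both blocks read decreasingly.  In the state
  -- `fixCount m₁ m₂ i₁ i₂ s₁ s₂ e₁ e₂` block k still has m_k free slots, its next free position is i_k, and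
  -- the flag s_k records whether it already holds a fixed point (a value at its own position); we count the
  -- ways to place the remaining values that end with the flags (e₁, e₂).  `finish` is the empty state,
  -- `place₁` and `place₂` put the current largest value m₁ + m₂ into block 1 and block 2.
  Counter : Set
  Counter = (m₁ m₂ i₁ i₂ : ℕ) (s₁ s₂ e₁ e₂ : Bool) → ℕ

  fixCount finish place₁ place₂ : Counter

  finish zero    zero    _ _ s₁ s₂ e₁ e₂ = 𝟙 ((s₁ == e₁) ∧ (s₂ == e₂))
  finish (suc _) _       _ _ _  _  _  _  = 0
  finish zero    (suc _) _ _ _  _  _  _  = 0

  place₁ zero      _  _  _  _  _  _  _  = 0
  place₁ (suc m₁) m₂ i₁ i₂ s₁ s₂ e₁ e₂ =
    fixCount m₁ m₂ (suc i₁) i₂ (mark s₁ (suc (m₁ + m₂)) i₁) s₂ e₁ e₂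

  place₂ _  zero      _  _  _  _  _  _  = 0
  place₂ m₁ (suc m₂) i₁ i₂ s₁ s₂ e₁ e₂ =
    fixCount m₁ m₂ i₁ (suc i₂) s₁ (mark s₂ (suc (m₁ + m₂)) i₂) e₁ e₂

  fixCount m₁ m₂ i₁ i₂ s₁ s₂ e₁ e₂ =
    finish m₁ m₂ i₁ i₂ s₁ s₂ e₁ e₂ + (place₁ m₁ m₂ i₁ i₂ s₁ s₂ e₁ e₂ + place₂ m₁ m₂ i₁ i₂ s₁ s₂ e₁ e₂)

  derangements : ℕ → ℕ → ℕ
  derangements m₁ m₂ = fixCount m₁ m₂ 1 (suc m₁) false false false false

  swap : ∀ m₁ m₂ i₁ i₂ s₁ s₂ e₁ e₂ → fixCount m₁ m₂ i₁ i₂ s₁ s₂ e₁ e₂ ≡ fixCount m₂ m₁ i₂ i₁ s₂ s₁ e₂ e₁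
  swap-finish : ∀ m₁ m₂ i₁ i₂ s₁ s₂ e₁ e₂ → finish m₁ m₂ i₁ i₂ s₁ s₂ e₁ e₂ ≡ finish m₂ m₁ i₂ i₁ s₂ s₁ e₂ e₁
  swap-place₁ : ∀ m₁ m₂ i₁ i₂ s₁ s₂ e₁ e₂ → place₁ m₁ m₂ i₁ i₂ s₁ s₂ e₁ e₂ ≡ place₂ m₂ m₁ i₂ i₁ s₂ s₁ e₂ e₁
  swap-place₂ : ∀ m₁ m₂ i₁ i₂ s₁ s₂ e₁ e₂ → place₂ m₁ m₂ i₁ i₂ s₁ s₂ e₁ e₂ ≡ place₁ m₂ m₁ i₂ i₁ s₂ s₁ e₂ e₁

  swap m₁ m₂ i₁ i₂ s₁ s₂ e₁ e₂ =
    cong₂ _+_ (swap-finish m₁ m₂ i₁ i₂ s₁ s₂ e₁ e₂)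
      (trans (cong₂ _+_ (swap-place₁ m₁ m₂ i₁ i₂ s₁ s₂ e₁ e₂) (swap-place₂ m₁ m₂ i₁ i₂ s₁ s₂ e₁ e₂))
             (+-comm (place₂ m₂ m₁ i₂ i₁ s₂ s₁ e₂ e₁) (place₁ m₂ m₁ i₂ i₁ s₂ s₁ e₂ e₁)))

  swap-finish zero    zero    _ _ s₁ s₂ e₁ e₂ = cong 𝟙 (∧-comm (s₁ == e₁) (s₂ == e₂))
  swap-finish (suc _) zero    _ _ _  _  _  _  = refl
  swap-finish (suc _) (suc _) _ _ _  _  _  _  = refl
  swap-finish zero    (suc _) _ _ _  _  _  _  = refl

  swap-place₁ zero      _  _  _  _  _  _  _  = refl
  swap-place₁ (suc m₁) m₂ i₁ i₂ s₁ s₂ e₁ e₂ =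
    trans (swap m₁ m₂ (suc i₁) i₂ _ s₂ e₁ e₂)
          (cong (λ n → fixCount m₂ m₁ i₂ (suc i₁) s₂ (mark s₁ (suc n) i₁) e₂ e₁) (+-comm m₁ m₂))

  swap-place₂ _  zero      _  _  _  _  _  _  = refl
  swap-place₂ m₁ (suc m₂) i₁ i₂ s₁ s₂ e₁ e₂ =
    trans (swap m₁ m₂ i₁ (suc i₂) s₁ _ e₁ e₂)
          (cong (λ n → fixCount m₂ m₁ (suc i₂) i₁ (mark s₂ (suc n) i₂) s₁ e₂ e₁) (+-comm m₁ m₂))

  -- A block is frozen when its flag can no longer change: it already holds a fixed point (`settled`), it
  -- has no free slot left (`full`), or every value still to be placed is smaller than its next position,
  -- hence than all its remaining positions (`passed`).  The indices are the flag, the free slots of this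
  -- block and of the other block, and the next position.
  data Frozen : Bool → ℕ → ℕ → ℕ → Set where
    settled : ∀ {m n i}   → Frozen true m n i
    full    : ∀ {s n i}   → Frozen s zero n i
    passed  : ∀ {s m n i} → m + n < i → Frozen s m n i

  Frozen-other : ∀ {s m n i} → Frozen s m (suc n) i → Frozen s m n i
  Frozen-other settled    = settled
  Frozen-other full       = full
  Frozen-other {m = m} (passed p) = passed (<-trans (+-monoʳ-< m (n<1+n _)) p)

  factor₃ : ∀ c {a b d a′ b′ d′} → a ≡ c * a′ → b ≡ c * b′ → d ≡ c * d′ → a + (b + d) ≡ c * (a′ + (b′ + d′))
  factor₃ c {a′ = a′} {b′} {d′} refl refl refl =
    sym (trans (*-distribˡ-+ c a′ (b′ + d′)) (cong (c * a′ +_) (*-distribˡ-+ c b′ d′)))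

  frozen₁ : ∀ m₁ m₂ i₁ j₁ i₂ s₁ s₂ e₁ e₂ → Frozen s₁ m₁ m₂ i₁ →
    fixCount m₁ m₂ i₁ i₂ s₁ s₂ e₁ e₂ ≡ 𝟙 (s₁ == e₁) * fixCount m₁ m₂ j₁ i₂ true s₂ true e₂
  frozen₁-finish : ∀ m₁ m₂ i₁ j₁ i₂ s₁ s₂ e₁ e₂ →
    finish m₁ m₂ i₁ i₂ s₁ s₂ e₁ e₂ ≡ 𝟙 (s₁ == e₁) * finish m₁ m₂ j₁ i₂ true s₂ true e₂
  frozen₁-place₁ : ∀ m₁ m₂ i₁ j₁ i₂ s₁ s₂ e₁ e₂ → Frozen s₁ m₁ m₂ i₁ →
    place₁ m₁ m₂ i₁ i₂ s₁ s₂ e₁ e₂ ≡ 𝟙 (s₁ == e₁) * place₁ m₁ m₂ j₁ i₂ true s₂ true e₂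
  frozen₁-place₂ : ∀ m₁ m₂ i₁ j₁ i₂ s₁ s₂ e₁ e₂ → Frozen s₁ m₁ m₂ i₁ →
    place₂ m₁ m₂ i₁ i₂ s₁ s₂ e₁ e₂ ≡ 𝟙 (s₁ == e₁) * place₂ m₁ m₂ j₁ i₂ true s₂ true e₂

  frozen₁ m₁ m₂ i₁ j₁ i₂ s₁ s₂ e₁ e₂ fr =
    factor₃ (𝟙 (s₁ == e₁)) (frozen₁-finish m₁ m₂ i₁ j₁ i₂ s₁ s₂ e₁ e₂)
            (frozen₁-place₁ m₁ m₂ i₁ j₁ i₂ s₁ s₂ e₁ e₂ fr)
            (frozen₁-place₂ m₁ m₂ i₁ j₁ i₂ s₁ s₂ e₁ e₂ fr)

  frozen₁-finish zero    zero    _ _ _ s₁ s₂ e₁ e₂ = 𝟙-∧ (s₁ == e₁) (s₂ == e₂)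
  frozen₁-finish (suc _) _       _ _ _ s₁ _  e₁ _  = sym (*-zeroʳ (𝟙 (s₁ == e₁)))
  frozen₁-finish zero    (suc _) _ _ _ s₁ _  e₁ _  = sym (*-zeroʳ (𝟙 (s₁ == e₁)))

  frozen₁-place₁ zero      _  _  _  _  s₁ _  e₁ _  _ = sym (*-zeroʳ (𝟙 (s₁ == e₁)))
  frozen₁-place₁ (suc m₁) m₂ i₁ j₁ i₂ .true s₂ e₁ e₂ settled =
    frozen₁ m₁ m₂ (suc i₁) (suc j₁) i₂ true s₂ e₁ e₂ settled
  frozen₁-place₁ (suc m₁) m₂ i₁ j₁ i₂ s₁ s₂ e₁ e₂ (passed v<i₁) =
    trans (cong (λ s → fixCount m₁ m₂ (suc i₁) i₂ s s₂ e₁ e₂) (mark-miss s₁ (<⇒≢ v<i₁)))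
          (frozen₁ m₁ m₂ (suc i₁) (suc j₁) i₂ s₁ s₂ e₁ e₂ (passed (<-trans (n<1+n _) (m<n⇒m<1+n v<i₁))))

  frozen₁-place₂ _  zero      _  _  _  s₁ _  e₁ _  _  = sym (*-zeroʳ (𝟙 (s₁ == e₁)))
  frozen₁-place₂ m₁ (suc m₂) i₁ j₁ i₂ s₁ s₂ e₁ e₂ fr =
    frozen₁ m₁ m₂ i₁ j₁ (suc i₂) s₁ _ e₁ e₂ (Frozen-other fr)

  frozen₂ : ∀ m₁ m₂ i₁ i₂ j₂ s₁ s₂ e₁ e₂ → Frozen s₂ m₂ m₁ i₂ →
    fixCount m₁ m₂ i₁ i₂ s₁ s₂ e₁ e₂ ≡ 𝟙 (s₂ == e₂) * fixCount m₁ m₂ i₁ j₂ s₁ true e₁ true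
  frozen₂ m₁ m₂ i₁ i₂ j₂ s₁ s₂ e₁ e₂ fr = begin
    fixCount m₁ m₂ i₁ i₂ s₁ s₂ e₁ e₂                   ≡⟨ swap m₁ m₂ i₁ i₂ s₁ s₂ e₁ e₂ ⟩
    fixCount m₂ m₁ i₂ i₁ s₂ s₁ e₂ e₁                   ≡⟨ frozen₁ m₂ m₁ i₂ j₂ i₁ s₂ s₁ e₂ e₁ fr ⟩
    𝟙 (s₂ == e₂) * fixCount m₂ m₁ j₂ i₁ true s₁ true e₁ ≡⟨ cong (𝟙 (s₂ == e₂) *_) (swap m₂ m₁ j₂ i₁ true s₁ true e₁) ⟩
    𝟙 (s₂ == e₂) * fixCount m₁ m₂ i₁ j₂ s₁ true e₁ true ∎
    where open ≡-Reasoning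

  relocate₁ : ∀ m₁ m₂ i₂ s₂ e₂ i₁ j₁ s₁ t₁ e₁ f₁ → Frozen s₁ m₁ m₂ i₁ → Frozen t₁ m₁ m₂ j₁ → (s₁ == e₁) ≡ (t₁ == f₁) →
    fixCount m₁ m₂ i₁ i₂ s₁ s₂ e₁ e₂ ≡ fixCount m₁ m₂ j₁ i₂ t₁ s₂ f₁ e₂
  relocate₁ m₁ m₂ i₂ s₂ e₂ i₁ j₁ s₁ t₁ e₁ f₁ fr fr′ same =
    trans (frozen₁ m₁ m₂ i₁ j₁ i₂ s₁ s₂ e₁ e₂ fr)
          (trans (cong (λ b → 𝟙 b * fixCount m₁ m₂ j₁ i₂ true s₂ true e₂) same)
                 (sym (frozen₁ m₁ m₂ j₁ j₁ i₂ t₁ s₂ f₁ e₂ fr′)))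

  relocate₂ : ∀ m₁ m₂ i₁ s₁ e₁ i₂ j₂ s₂ t₂ e₂ f₂ → Frozen s₂ m₂ m₁ i₂ → Frozen t₂ m₂ m₁ j₂ → (s₂ == e₂) ≡ (t₂ == f₂) →
    fixCount m₁ m₂ i₁ i₂ s₁ s₂ e₁ e₂ ≡ fixCount m₁ m₂ i₁ j₂ s₁ t₂ e₁ f₂
  relocate₂ m₁ m₂ i₁ s₁ e₁ i₂ j₂ s₂ t₂ e₂ f₂ fr fr′ same =
    trans (frozen₂ m₁ m₂ i₁ i₂ j₂ s₁ s₂ e₁ e₂ fr)
          (trans (cong (λ b → 𝟙 b * fixCount m₁ m₂ i₁ j₂ s₁ true e₁ true) same)
                 (sym (frozen₂ m₁ m₂ i₁ j₂ j₂ s₁ t₂ e₁ f₂ fr′)))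

  finish-vanishes : ∀ m₁ m₂ i₁ i₂ s₁ s₂ e₁ e₂ → 0 < m₁ + m₂ → finish m₁ m₂ i₁ i₂ s₁ s₂ e₁ e₂ ≡ 0
  finish-vanishes zero    zero    _ _ _ _ _ _ ()
  finish-vanishes (suc _) _       _ _ _ _ _ _ _ = refl
  finish-vanishes zero    (suc _) _ _ _ _ _ _ _ = refl

  flag₁-factor : ∀ m₁ m₂ i₁ i₂ b s₂ e₂ →
    fixCount m₁ m₂ i₁ i₂ b s₂ false e₂ ≡ 𝟙 (not b) * fixCount m₁ m₂ i₁ i₂ false s₂ false e₂
  flag₁-factor m₁ m₂ i₁ i₂ true  s₂ e₂ = frozen₁ m₁ m₂ i₁ i₁ i₂ true s₂ false e₂ settled
  flag₁-factor m₁ m₂ i₁ i₂ false s₂ e₂ = sym (*-identityˡ _)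

  flag₂-factor : ∀ m₁ m₂ i₁ i₂ s₁ b e₁ →
    fixCount m₁ m₂ i₁ i₂ s₁ b e₁ false ≡ 𝟙 (not b) * fixCount m₁ m₂ i₁ i₂ s₁ false e₁ false
  flag₂-factor m₁ m₂ i₁ i₂ s₁ true  e₁ = frozen₂ m₁ m₂ i₁ i₂ i₂ s₁ true e₁ false settled
  flag₂-factor m₁ m₂ i₁ i₂ s₁ false e₁ = sym (*-identityˡ _)

  ∑ : {A : Set} → List A → (A → ℕ) → ℕ
  ∑ []       f = 0
  ∑ (x ∷ xs) f = f x + ∑ xs f

  ∑-++ : ∀ {A : Set} (xs ys : List A) f → ∑ (xs ++ ys) f ≡ ∑ xs f + ∑ ys f
  ∑-++ []       ys f = refl
  ∑-++ (x ∷ xs) ys f = trans (cong (f x +_) (∑-++ xs ys f)) (sym (+-assoc (f x) _ _))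

  ∑-cong : ∀ {A : Set} xs {f g : A → ℕ} → (∀ x → f x ≡ g x) → ∑ xs f ≡ ∑ xs g
  ∑-cong []       f≗g = refl
  ∑-cong (x ∷ xs) f≗g = cong₂ _+_ (f≗g x) (∑-cong xs f≗g)

  ∑-cong-All : ∀ {A : Set} {P : A → Set} {xs} {f g : A → ℕ} → All P xs → (∀ {x} → P x → f x ≡ g x) → ∑ xs f ≡ ∑ xs g
  ∑-cong-All []         f≗g = refl
  ∑-cong-All (px ∷ pxs) f≗g = cong₂ _+_ (f≗g px) (∑-cong-All pxs f≗g)

  ∑-scale : ∀ {A : Set} xs c (f : A → ℕ) → ∑ xs (λ x → c * f x) ≡ c * ∑ xs f
  ∑-scale []       c f = sym (*-zeroʳ c)
  ∑-scale (x ∷ xs) c f = trans (cong (c * f x +_) (∑-scale xs c f)) (sym (*-distribˡ-+ c (f x) _))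

  ∑-concatMap : ∀ {A B : Set} (g : A → List B) xs f → ∑ (concatMap g xs) f ≡ ∑ xs (λ x → ∑ (g x) f)
  ∑-concatMap g []       f = refl
  ∑-concatMap g (x ∷ xs) f = trans (∑-++ (g x) _ f) (cong (∑ (g x) f +_) (∑-concatMap g xs f))

  ∑-map : ∀ {A B : Set} (g : A → B) xs f → ∑ (map g xs) f ≡ ∑ xs (λ x → f (g x))
  ∑-map g []       f = refl
  ∑-map g (x ∷ xs) f = cong (f (g x) +_) (∑-map g xs f)

  ∑-filter : ∀ {A : Set} (p : A → Bool) xs f → ∑ (filter (λ x → p x Bool.≟ true) xs) f ≡ ∑ xs (λ x → 𝟙 (p x) * f x)
  ∑-filter p []       f = refl
  ∑-filter p (x ∷ xs) f with p x
  ... | true  = cong₂ _+_ (sym (+-identityʳ (f x))) (∑-filter p xs f)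
  ... | false = ∑-filter p xs f

  length-filter : ∀ {A : Set} (p : A → Bool) xs → length (filter (λ x → p x Bool.≟ true) xs) ≡ ∑ xs (λ x → 𝟙 (p x))
  length-filter p []       = refl
  length-filter p (x ∷ xs) with p x
  ... | true  = cong suc (length-filter p xs)
  ... | false = length-filter p xs

  -- A sum over 0,1,…,n whose terms vanish after the first; G(a,b,0) has only the term m = 0.
  sum-upTo-first : ∀ (t : ℕ → ℕ) n → (∀ x → t (suc x) ≡ 0) → sum (map t (upTo (suc n))) ≡ t 0
  sum-upTo-first t n t-vanishes = trans (cong (t 0 +_) (rest (λ x → x) n)) (+-identityʳ (t 0))
    where
    rest : ∀ (g : ℕ → ℕ) n → sum (map t (applyUpTo (λ x → suc (g x)) n)) ≡ 0
    rest g zero    = refl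
    rest g (suc n) = cong₂ _+_ (t-vanishes (g 0)) (rest (λ x → g (suc x)) n)

  range1-all : ∀ k → All (_≤ k) (range1 k)
  range1-all k = map⁺ (all-upTo k)

  range1-suc : ∀ k → range1 (suc k) ≡ range1 k ++ (suc k ∷ [])
  range1-suc k = trans (cong (map suc) (sym (upTo-∷ʳ k))) (map-++ suc (upTo k) (k ∷ []))

  ∑-range1-suc : ∀ k f → ∑ (range1 (suc k)) f ≡ ∑ (range1 k) f + f (suc k)
  ∑-range1-suc k f =
    trans (cong (λ ys → ∑ ys f) (range1-suc k))
          (trans (∑-++ (range1 k) (suc k ∷ []) f) (cong (∑ (range1 k) f +_) (+-identityʳ (f (suc k)))))

  ∑W : ℕ → ℕ → (List ℕ → ℕ) → ℕ
  ∑W k zero    F = F []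
  ∑W k (suc n) F = ∑ (range1 k) (λ x → ∑W k n (λ w → F (x ∷ w)))

  ∑-words : ∀ k n F → ∑ (words k n) F ≡ ∑W k n F
  ∑-words k zero    F = +-identityʳ (F [])
  ∑-words k (suc n) F =
    trans (∑-concatMap (λ x → map (x ∷_) (words k n)) (range1 k) F)
          (∑-cong (range1 k) (λ x → trans (∑-map (x ∷_) (words k n) F) (∑-words k n (λ w → F (x ∷ w)))))

  ∑W-cong : ∀ k n {F G : List ℕ → ℕ} → (∀ w → All (_≤ k) w → length w ≡ n → F w ≡ G w) → ∑W k n F ≡ ∑W k n G
  ∑W-cong k zero    F≗G = F≗G [] [] refl
  ∑W-cong k (suc n) F≗G =
    ∑-cong-All (range1-all k) (λ {x} x≤k → ∑W-cong k n (λ w w≤k |w| → F≗G (x ∷ w) (x≤k ∷ w≤k) (cong suc |w|)))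

  ∑W-scale : ∀ k n c (F : List ℕ → ℕ) → ∑W k n (λ w → c * F w) ≡ c * ∑W k n F
  ∑W-scale k zero    c F = refl
  ∑W-scale k (suc n) c F =
    trans (∑-cong (range1 k) (λ x → ∑W-scale k n c (λ w → F (x ∷ w)))) (∑-scale (range1 k) c _)

  ∑W-split : ∀ k m n (F : List ℕ → ℕ) → ∑W k (m + n) F ≡ ∑W k m (λ u → ∑W k n (λ v → F (u ++ v)))
  ∑W-split k zero    n F = refl
  ∑W-split k (suc m) n F = ∑-cong (range1 k) (λ x → ∑W-split k m n (λ w → F (x ∷ w)))

  below : ℕ → List ℕ → Bool
  below x []      = true
  below x (y ∷ w) = (y <ᵇ x) ∧ below y w

  decreasing : List ℕ → Bool
  decreasing []      = true
  decreasing (x ∷ w) = below x w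

  <ᵇ-true : ∀ {y x} → y < x → (y <ᵇ x) ≡ true
  <ᵇ-true y<x = Equivalence.to T-≡ (<⇒<ᵇ y<x)

  <ᵇ-false : ∀ {y x} → x ≤ y → (y <ᵇ x) ≡ false
  <ᵇ-false {y} {x} x≤y = ¬-not (λ y<ᵇx → ≤⇒≯ x≤y (<ᵇ⇒< y x (Equivalence.from T-≡ y<ᵇx)))

  below-top : ∀ k w → All (_≤ k) w → below (suc k) w ≡ decreasing w
  below-top k []      []           = refl
  below-top k (y ∷ w) (y≤k ∷ w≤k) = cong (_∧ below y w) (<ᵇ-true (s≤s y≤k))

  𝟙-∧-swap : ∀ a b c → 𝟙 (a ∧ b) * c ≡ 𝟙 b * (𝟙 a * c)
  𝟙-∧-swap true  b c = cong (𝟙 b *_) (sym (*-identityˡ c))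
  𝟙-∧-swap false b c = sym (*-zeroʳ (𝟙 b))

  -- Words below x ≤ k+1 never use the letter k+1, so the alphabet can shrink to {1,…,k}.
  ∑W-below-shrink : ∀ k m x (F : List ℕ → ℕ) → x ≤ suc k →
    ∑W (suc k) m (λ w → 𝟙 (below x w) * F w) ≡ ∑W k m (λ w → 𝟙 (below x w) * F w)
  ∑W-below-shrink k zero    x F x≤k+1 = refl
  ∑W-below-shrink k (suc m) x F x≤k+1 = begin
    ∑ (range1 (suc k)) term
      ≡⟨ ∑-range1-suc k term ⟩
    ∑ (range1 k) term + term (suc k)
      ≡⟨ cong₂ _+_ (∑-cong-All (range1-all k) (λ {y} y≤k → shrink y y≤k)) top-vanishes ⟩
    ∑W k (suc m) (λ w → 𝟙 (below x w) * F w) + 0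
      ≡⟨ +-identityʳ _ ⟩
    ∑W k (suc m) (λ w → 𝟙 (below x w) * F w) ∎
    where
    open ≡-Reasoning
    term : ℕ → ℕ
    term y = ∑W (suc k) m (λ w → 𝟙 ((y <ᵇ x) ∧ below y w) * F (y ∷ w))
    shrink : ∀ y → y ≤ k → term y ≡ ∑W k m (λ w → 𝟙 ((y <ᵇ x) ∧ below y w) * F (y ∷ w))
    shrink y y≤k = begin
      term y
        ≡⟨ ∑W-cong (suc k) m (λ w _ _ → 𝟙-∧-swap (y <ᵇ x) (below y w) (F (y ∷ w))) ⟩
      ∑W (suc k) m (λ w → 𝟙 (below y w) * (𝟙 (y <ᵇ x) * F (y ∷ w)))
        ≡⟨ ∑W-below-shrink k m y (λ w → 𝟙 (y <ᵇ x) * F (y ∷ w)) (m≤n⇒m≤1+n y≤k) ⟩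
      ∑W k m (λ w → 𝟙 (below y w) * (𝟙 (y <ᵇ x) * F (y ∷ w)))
        ≡⟨ ∑W-cong k m (λ w _ _ → 𝟙-∧-swap (y <ᵇ x) (below y w) (F (y ∷ w))) ⟨
      ∑W k m (λ w → 𝟙 ((y <ᵇ x) ∧ below y w) * F (y ∷ w)) ∎
    top-vanishes : term (suc k) ≡ 0
    top-vanishes =
      trans (∑W-cong (suc k) m (λ w _ _ → cong (λ b → 𝟙 (b ∧ below (suc k) w) * F (suc k ∷ w)) (<ᵇ-false x≤k+1)))
            (∑W-scale (suc k) m 0 (λ _ → 0))

  -- A decreasing word over {1,…,k+1} either avoids k+1 or starts with it.
  ∑W-decreasing-top : ∀ k m (F : List ℕ → ℕ) →
    ∑W (suc k) (suc m) (λ u → 𝟙 (decreasing u) * F u)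
    ≡ ∑W k (suc m) (λ u → 𝟙 (decreasing u) * F u) + ∑W k m (λ u → 𝟙 (decreasing u) * F (suc k ∷ u))
  ∑W-decreasing-top k m F = begin
    ∑ (range1 (suc k)) term
      ≡⟨ ∑-range1-suc k term ⟩
    ∑ (range1 k) term + term (suc k)
      ≡⟨ cong₂ _+_ (∑-cong-All (range1-all k) (λ {y} y≤k → ∑W-below-shrink k m y (λ w → F (y ∷ w)) (m≤n⇒m≤1+n y≤k)))
                   top ⟩
    ∑W k (suc m) (λ u → 𝟙 (decreasing u) * F u) + ∑W k m (λ u → 𝟙 (decreasing u) * F (suc k ∷ u)) ∎
    where
    open ≡-Reasoning
    term : ℕ → ℕ
    term y = ∑W (suc k) m (λ w → 𝟙 (below y w) * F (y ∷ w))
    top : term (suc k) ≡ ∑W k m (λ u → 𝟙 (decreasing u) * F (suc k ∷ u))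
    top = trans (∑W-below-shrink k m (suc k) (λ w → F (suc k ∷ w)) ≤-refl)
                (∑W-cong k m (λ w w≤k _ → cong (λ b → 𝟙 b * F (suc k ∷ w)) (below-top k w w≤k)))

  -- `decSum k m F` is the sum of F over the strictly decreasing words of length m over {1,…,k},
  -- i.e. over the m-subsets of {1,…,k}, defined by the same case distinction on the largest letter.
  decSum : ℕ → ℕ → (List ℕ → ℕ) → ℕ
  decSum k       zero    F = F []
  decSum zero    (suc m) F = 0
  decSum (suc k) (suc m) F = decSum k (suc m) F + decSum k m (λ w → F (suc k ∷ w))

  ∑W-decreasing : ∀ k m (F : List ℕ → ℕ) → ∑W k m (λ u → 𝟙 (decreasing u) * F u) ≡ decSum k m F
  ∑W-decreasing k       zero    F = *-identityˡ (F [])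
  ∑W-decreasing zero    (suc m) F = refl
  ∑W-decreasing (suc k) (suc m) F =
    trans (∑W-decreasing-top k m F)
          (cong₂ _+_ (∑W-decreasing k (suc m) F) (∑W-decreasing k m (λ w → F (suc k ∷ w))))

  decSum-cong : ∀ k m {F G : List ℕ → ℕ} → (∀ w → All (_≤ k) w → F w ≡ G w) → decSum k m F ≡ decSum k m G
  decSum-cong k       zero    F≗G = F≗G [] []
  decSum-cong zero    (suc m) F≗G = refl
  decSum-cong (suc k) (suc m) F≗G =
    cong₂ _+_ (decSum-cong k (suc m) (λ w w≤k → F≗G w (All.map m≤n⇒m≤1+n w≤k)))
              (decSum-cong k m (λ w w≤k → F≗G (suc k ∷ w) (≤-refl ∷ All.map m≤n⇒m≤1+n w≤k)))

  decSum-+ : ∀ k m (F G : List ℕ → ℕ) → decSum k m (λ w → F w + G w) ≡ decSum k m F + decSum k m G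
  decSum-+ k       zero    F G = refl
  decSum-+ zero    (suc m) F G = refl
  decSum-+ (suc k) (suc m) F G =
    trans (cong₂ _+_ (decSum-+ k (suc m) F G) (decSum-+ k m (λ w → F (suc k ∷ w)) (λ w → G (suc k ∷ w))))
          (interchange (decSum k (suc m) F) (decSum k (suc m) G)
                       (decSum k m (λ w → F (suc k ∷ w))) (decSum k m (λ w → G (suc k ∷ w))))

  decSum-scale : ∀ k m c (F : List ℕ → ℕ) → decSum k m (λ w → c * F w) ≡ c * decSum k m F
  decSum-scale k       zero    c F = refl
  decSum-scale zero    (suc m) c F = sym (*-zeroʳ c)
  decSum-scale (suc k) (suc m) c F =
    trans (cong₂ _+_ (decSum-scale k (suc m) c F) (decSum-scale k m c (λ w → F (suc k ∷ w))))
          (sym (*-distribˡ-+ c _ _))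

  decSum-zero : ∀ k m → decSum k m (λ _ → 0) ≡ 0
  decSum-zero k m = decSum-scale k m 0 (λ _ → 0)

  topSum : ℕ → ℕ → (List ℕ → ℕ) → ℕ
  topSum k zero    F = 0
  topSum k (suc m) F = decSum k m (λ w → F (suc k ∷ w))

  decSum-top : ∀ k m F → decSum (suc k) m F ≡ decSum k m F + topSum k m F
  decSum-top k zero    F = sym (+-identityʳ (F []))
  decSum-top k (suc m) F = refl

  disjoint : List ℕ → List ℕ → Bool
  disjoint []      v = true
  disjoint (x ∷ u) v = not (elemᵇ x v) ∧ disjoint u v

  elemᵇ-above : ∀ k v → All (_≤ k) v → elemᵇ (suc k) v ≡ false
  elemᵇ-above k []      []           = refl
  elemᵇ-above k (y ∷ v) (y≤k ∷ v≤k) = cong₂ _∨_ (≡ᵇ-false (>⇒≢ (s≤s y≤k))) (elemᵇ-above k v v≤k)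

  disjoint-top-left : ∀ k u v → All (_≤ k) v → disjoint (suc k ∷ u) v ≡ disjoint u v
  disjoint-top-left k u v v≤k = cong (λ b → not b ∧ disjoint u v) (elemᵇ-above k v v≤k)

  disjoint-top-right : ∀ k u v → All (_≤ k) u → disjoint u (suc k ∷ v) ≡ disjoint u v
  disjoint-top-right k []      v []           = refl
  disjoint-top-right k (x ∷ u) v (x≤k ∷ u≤k) =
    cong₂ (λ b c → not (b ∨ elemᵇ x v) ∧ c) (≡ᵇ-false (<⇒≢ (s≤s x≤k))) (disjoint-top-right k u v u≤k)

  disjoint-clash : ∀ k u v → disjoint (suc k ∷ u) (suc k ∷ v) ≡ false
  disjoint-clash k u v = cong (λ b → not (b ∨ elemᵇ (suc k) v) ∧ disjoint u (suc k ∷ v)) (≡ᵇ-refl (suc k))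

  -- The sum of Φ u v over the pairs of disjoint decreasing words u, v of lengths m₁, m₂ over {1,…,k}.
  -- G(a,b,0) is such a sum, and its recursion on k reproduces the recursion of fixCount.
  pairSum : ℕ → ℕ → ℕ → (List ℕ → List ℕ → ℕ) → ℕ
  pairSum k m₁ m₂ Φ = decSum k m₁ (λ u → decSum k m₂ (λ v → 𝟙 (disjoint u v) * Φ u v))

  pairSum-cong : ∀ k m₁ m₂ {Φ Ψ : List ℕ → List ℕ → ℕ} → (∀ u v → Φ u v ≡ Ψ u v) → pairSum k m₁ m₂ Φ ≡ pairSum k m₁ m₂ Ψ
  pairSum-cong k m₁ m₂ Φ≗Ψ =
    decSum-cong k m₁ (λ u _ → decSum-cong k m₂ (λ v _ → cong (𝟙 (disjoint u v) *_) (Φ≗Ψ u v)))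

  pairSum-scale : ∀ k m₁ m₂ c Φ → pairSum k m₁ m₂ (λ u v → c * Φ u v) ≡ c * pairSum k m₁ m₂ Φ
  pairSum-scale k m₁ m₂ c Φ =
    trans (decSum-cong k m₁ (λ u _ →
             trans (decSum-cong k m₂ (λ v _ → *-swap (𝟙 (disjoint u v)) c (Φ u v)))
                   (decSum-scale k m₂ c (λ v → 𝟙 (disjoint u v) * Φ u v))))
          (decSum-scale k m₁ c _)

  topPair₁ topPair₂ : ℕ → ℕ → ℕ → (List ℕ → List ℕ → ℕ) → ℕ
  topPair₁ k zero     m₂ Φ = 0
  topPair₁ k (suc m₁) m₂ Φ = pairSum k m₁ m₂ (λ u v → Φ (suc k ∷ u) v)
  topPair₂ k m₁ zero     Φ = 0
  topPair₂ k m₁ (suc m₂) Φ = pairSum k m₁ m₂ (λ u v → Φ u (suc k ∷ v))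

  top₁-part : ∀ k m₁ m₂ Φ →
    topSum k m₁ (λ u → decSum (suc k) m₂ (λ v → 𝟙 (disjoint u v) * Φ u v)) ≡ topPair₁ k m₁ m₂ Φ
  top₁-part k zero     m₂ Φ = refl
  top₁-part k (suc m₁) m₂ Φ = decSum-cong k m₁ (λ u _ → begin
    decSum (suc k) m₂ (λ v → 𝟙 (disjoint (suc k ∷ u) v) * Φ (suc k ∷ u) v)
      ≡⟨ decSum-top k m₂ _ ⟩
    decSum k m₂ (λ v → 𝟙 (disjoint (suc k ∷ u) v) * Φ (suc k ∷ u) v)
      + topSum k m₂ (λ v → 𝟙 (disjoint (suc k ∷ u) v) * Φ (suc k ∷ u) v)
      ≡⟨ cong₂ _+_ (decSum-cong k m₂ (λ v v≤k → cong (λ b → 𝟙 b * Φ (suc k ∷ u) v) (disjoint-top-left k u v v≤k)))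
                   (clash m₂ u) ⟩
    decSum k m₂ (λ v → 𝟙 (disjoint u v) * Φ (suc k ∷ u) v) + 0
      ≡⟨ +-identityʳ _ ⟩
    decSum k m₂ (λ v → 𝟙 (disjoint u v) * Φ (suc k ∷ u) v) ∎)
    where
    open ≡-Reasoning
    clash : ∀ m₂ u → topSum k m₂ (λ v → 𝟙 (disjoint (suc k ∷ u) v) * Φ (suc k ∷ u) v) ≡ 0
    clash zero     u = refl
    clash (suc m₂) u =
      trans (decSum-cong k m₂ (λ v _ → cong (λ b → 𝟙 b * Φ (suc k ∷ u) (suc k ∷ v)) (disjoint-clash k u v)))
            (decSum-zero k m₂)

  top₂-part : ∀ k m₁ m₂ Φ →
    decSum k m₁ (λ u → topSum k m₂ (λ v → 𝟙 (disjoint u v) * Φ u v)) ≡ topPair₂ k m₁ m₂ Φ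
  top₂-part k m₁ zero     Φ = decSum-zero k m₁
  top₂-part k m₁ (suc m₂) Φ =
    decSum-cong k m₁ (λ u u≤k → decSum-cong k m₂ (λ v _ →
      cong (λ b → 𝟙 b * Φ u (suc k ∷ v)) (disjoint-top-right k u v u≤k)))

  -- The letter k+1 occurs in neither word, or it is the first letter of u, or of v.
  pairSum-top : ∀ k m₁ m₂ Φ → pairSum (suc k) m₁ m₂ Φ ≡ pairSum k m₁ m₂ Φ + (topPair₁ k m₁ m₂ Φ + topPair₂ k m₁ m₂ Φ)
  pairSum-top k m₁ m₂ Φ = begin
    decSum (suc k) m₁ (inner (suc k))
      ≡⟨ decSum-top k m₁ (inner (suc k)) ⟩
    decSum k m₁ (inner (suc k)) + topSum k m₁ (inner (suc k))
      ≡⟨ cong (_+ topSum k m₁ (inner (suc k))) (decSum-cong k m₁ (λ u _ → decSum-top k m₂ (Ψ u))) ⟩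
    decSum k m₁ (λ u → inner k u + topSum k m₂ (Ψ u)) + topSum k m₁ (inner (suc k))
      ≡⟨ cong (_+ topSum k m₁ (inner (suc k))) (decSum-+ k m₁ (inner k) (λ u → topSum k m₂ (Ψ u))) ⟩
    pairSum k m₁ m₂ Φ + decSum k m₁ (λ u → topSum k m₂ (Ψ u)) + topSum k m₁ (inner (suc k))
      ≡⟨ cong₂ (λ a b → pairSum k m₁ m₂ Φ + a + b) (top₂-part k m₁ m₂ Φ) (top₁-part k m₁ m₂ Φ) ⟩
    pairSum k m₁ m₂ Φ + topPair₂ k m₁ m₂ Φ + topPair₁ k m₁ m₂ Φ
      ≡⟨ +-assoc (pairSum k m₁ m₂ Φ) _ _ ⟩
    pairSum k m₁ m₂ Φ + (topPair₂ k m₁ m₂ Φ + topPair₁ k m₁ m₂ Φ)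
      ≡⟨ cong (pairSum k m₁ m₂ Φ +_) (+-comm (topPair₂ k m₁ m₂ Φ) _) ⟩
    pairSum k m₁ m₂ Φ + (topPair₁ k m₁ m₂ Φ + topPair₂ k m₁ m₂ Φ) ∎
    where
    open ≡-Reasoning
    Ψ : List ℕ → List ℕ → ℕ
    Ψ u v = 𝟙 (disjoint u v) * Φ u v
    inner : ℕ → List ℕ → ℕ
    inner k′ u = decSum k′ m₂ (Ψ u)

  -- Pigeonhole: m₁ + m₂ distinct letters do not fit into an alphabet of size k < m₁ + m₂.
  pairSum-empty : ∀ k m₁ m₂ Φ → k < m₁ + m₂ → pairSum k m₁ m₂ Φ ≡ 0
  pairSum-empty zero    zero     zero     Φ ()
  pairSum-empty zero    (suc m₁) m₂       Φ _ = refl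
  pairSum-empty zero    zero     (suc m₂) Φ _ = refl
  pairSum-empty (suc k) m₁       m₂       Φ k<m =
    trans (pairSum-top k m₁ m₂ Φ)
          (cong₂ _+_ (pairSum-empty k m₁ m₂ Φ (<-trans (n<1+n k) k<m)) (cong₂ _+_ (top₁ m₁ k<m) (top₂ m₂ k<m)))
    where
    top₁ : ∀ m₁ → suc k < m₁ + m₂ → topPair₁ k m₁ m₂ Φ ≡ 0
    top₁ zero     _   = refl
    top₁ (suc m₁) k<m = pairSum-empty k m₁ m₂ _ (s<s⁻¹ k<m)
    top₂ : ∀ m₂ → suc k < m₁ + m₂ → topPair₂ k m₁ m₂ Φ ≡ 0
    top₂ zero     _   = refl
    top₂ (suc m₂) k<m = pairSum-empty k m₁ m₂ _ (s<s⁻¹ (subst (suc k <_) (+-suc m₁ m₂) k<m))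

  fixedFree : ℕ → List ℕ → Bool
  fixedFree i []      = true
  fixedFree i (x ∷ w) = not (x ≡ᵇ i) ∧ fixedFree (suc i) w

  noFixed : ℕ → ℕ → List ℕ → List ℕ → ℕ
  noFixed i₁ i₂ u v = 𝟙 (fixedFree i₁ u ∧ fixedFree i₂ v)

  -- Over an alphabet of exactly m₁ + m₂ letters, the pairs of disjoint decreasing words without fixed
  -- points are counted by fixCount: the largest letter must be used, and putting it first in u or in v is
  -- `place₁` or `place₂`.  The factor 𝟙 (k+1 ≠ i) of the fixed-point condition becomes the flag update.
  BridgeAt : ℕ → Set
  BridgeAt k = ∀ m₁ m₂ i₁ i₂ → k ≡ m₁ + m₂ →
    pairSum k m₁ m₂ (noFixed i₁ i₂) ≡ fixCount m₁ m₂ i₁ i₂ false false false false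

  bridge-top₁ : ∀ k → BridgeAt k → ∀ m₁ m₂ i₁ i₂ → suc k ≡ m₁ + m₂ →
    topPair₁ k m₁ m₂ (noFixed i₁ i₂) ≡ place₁ m₁ m₂ i₁ i₂ false false false false
  bridge-top₁ k bridge-k zero     m₂ i₁ i₂ _  = refl
  bridge-top₁ k bridge-k (suc m₁) m₂ i₁ i₂ eq = begin
    pairSum k m₁ m₂ (λ u v → noFixed i₁ i₂ (suc k ∷ u) v)
      ≡⟨ pairSum-cong k m₁ m₂ (λ u v → trans (cong 𝟙 (∧-assoc (not hit) (fixedFree (suc i₁) u) (fixedFree i₂ v)))
                                             (𝟙-∧ (not hit) _)) ⟩
    pairSum k m₁ m₂ (λ u v → 𝟙 (not hit) * noFixed (suc i₁) i₂ u v)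
      ≡⟨ pairSum-scale k m₁ m₂ (𝟙 (not hit)) (noFixed (suc i₁) i₂) ⟩
    𝟙 (not hit) * pairSum k m₁ m₂ (noFixed (suc i₁) i₂)
      ≡⟨ cong (𝟙 (not hit) *_) (bridge-k m₁ m₂ (suc i₁) i₂ (suc-injective eq)) ⟩
    𝟙 (not hit) * fixCount m₁ m₂ (suc i₁) i₂ false false false false
      ≡⟨ flag₁-factor m₁ m₂ (suc i₁) i₂ hit false false ⟨
    fixCount m₁ m₂ (suc i₁) i₂ hit false false false
      ≡⟨ cong (λ n → fixCount m₁ m₂ (suc i₁) i₂ (n ≡ᵇ i₁) false false false) eq ⟩
    fixCount m₁ m₂ (suc i₁) i₂ (mark false (suc (m₁ + m₂)) i₁) false false false ∎
    where
    open ≡-Reasoning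
    hit = suc k ≡ᵇ i₁

  bridge-top₂ : ∀ k → BridgeAt k → ∀ m₁ m₂ i₁ i₂ → suc k ≡ m₁ + m₂ →
    topPair₂ k m₁ m₂ (noFixed i₁ i₂) ≡ place₂ m₁ m₂ i₁ i₂ false false false false
  bridge-top₂ k bridge-k m₁ zero     i₁ i₂ _  = refl
  bridge-top₂ k bridge-k m₁ (suc m₂) i₁ i₂ eq = begin
    pairSum k m₁ m₂ (λ u v → noFixed i₁ i₂ u (suc k ∷ v))
      ≡⟨ pairSum-cong k m₁ m₂ (λ u v → trans (cong 𝟙 (∧-swap (fixedFree i₁ u) (not hit) (fixedFree (suc i₂) v)))
                                             (𝟙-∧ (not hit) _)) ⟩
    pairSum k m₁ m₂ (λ u v → 𝟙 (not hit) * noFixed i₁ (suc i₂) u v)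
      ≡⟨ pairSum-scale k m₁ m₂ (𝟙 (not hit)) (noFixed i₁ (suc i₂)) ⟩
    𝟙 (not hit) * pairSum k m₁ m₂ (noFixed i₁ (suc i₂))
      ≡⟨ cong (𝟙 (not hit) *_) (bridge-k m₁ m₂ i₁ (suc i₂) (suc-injective (trans eq (+-suc m₁ m₂)))) ⟩
    𝟙 (not hit) * fixCount m₁ m₂ i₁ (suc i₂) false false false false
      ≡⟨ flag₂-factor m₁ m₂ i₁ (suc i₂) false hit false ⟨
    fixCount m₁ m₂ i₁ (suc i₂) false hit false false
      ≡⟨ cong (λ n → fixCount m₁ m₂ i₁ (suc i₂) false (n ≡ᵇ i₂) false false) (trans eq (+-suc m₁ m₂)) ⟩
    fixCount m₁ m₂ i₁ (suc i₂) false (mark false (suc (m₁ + m₂)) i₂) false false ∎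
    where
    open ≡-Reasoning
    hit = suc k ≡ᵇ i₂

  bridge : ∀ k → BridgeAt k
  bridge zero    zero     zero     i₁ i₂ _  = refl
  bridge (suc k) m₁       m₂       i₁ i₂ eq = begin
    pairSum (suc k) m₁ m₂ (noFixed i₁ i₂)
      ≡⟨ pairSum-top k m₁ m₂ (noFixed i₁ i₂) ⟩
    pairSum k m₁ m₂ (noFixed i₁ i₂) + (topPair₁ k m₁ m₂ (noFixed i₁ i₂) + topPair₂ k m₁ m₂ (noFixed i₁ i₂))
      ≡⟨ cong₂ _+_ (trans (pairSum-empty k m₁ m₂ (noFixed i₁ i₂) (≤-reflexive eq))
                          (sym (finish-vanishes m₁ m₂ i₁ i₂ false false false false (subst (0 <_) eq z<s))))
                   (cong₂ _+_ (bridge-top₁ k (bridge k) m₁ m₂ i₁ i₂ eq) (bridge-top₂ k (bridge k) m₁ m₂ i₁ i₂ eq)) ⟩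
    fixCount m₁ m₂ i₁ i₂ false false false false ∎
    where open ≡-Reasoning

  elemᵇ-++ : ∀ x u v → elemᵇ x (u ++ v) ≡ elemᵇ x u ∨ elemᵇ x v
  elemᵇ-++ x []      v = refl
  elemᵇ-++ x (y ∷ u) v = trans (cong ((x ≡ᵇ y) ∨_) (elemᵇ-++ x u v)) (sym (∨-assoc (x ≡ᵇ y) _ _))

  distinct-++ : ∀ u v → distinct (u ++ v) ≡ (distinct u ∧ disjoint u v) ∧ distinct v
  distinct-++ []      v = refl
  distinct-++ (x ∷ u) v =
    trans (cong₂ (λ a b → not a ∧ b) (elemᵇ-++ x u v) (distinct-++ u v))
          (trans (cong (_∧ ((distinct u ∧ disjoint u v) ∧ distinct v)) (not-∨ (elemᵇ x u) (elemᵇ x v)))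
                 (regroup (not (elemᵇ x u)) (not (elemᵇ x v)) (distinct u) (disjoint u v) (distinct v)))
    where
    not-∨ : ∀ a b → not (a ∨ b) ≡ not a ∧ not b
    not-∨ true  b = refl
    not-∨ false b = refl
    regroup : ∀ p q r s t → (p ∧ q) ∧ ((r ∧ s) ∧ t) ≡ ((p ∧ r) ∧ (q ∧ s)) ∧ t
    regroup false q     r s t = refl
    regroup true  true  r s t = refl
    regroup true  false r s t = sym (cong (_∧ t) (∧-zeroʳ r))

  descOK-one-block : ∀ v → descOK (replicate (length v) 1 ++ []) v ≡ decreasing v
  descOK-one-block []          = refl
  descOK-one-block (x ∷ [])     = refl
  descOK-one-block (x ∷ y ∷ w) = cong ((y <ᵇ x) ∧_) (descOK-one-block (y ∷ w))

  descOK-two-blocks : ∀ u v →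
    descOK (replicate (length u) 0 ++ (replicate (length v) 1 ++ [])) (u ++ v) ≡ decreasing u ∧ decreasing v
  descOK-two-blocks []          v       = descOK-one-block v
  descOK-two-blocks (x ∷ [])     []      = refl
  descOK-two-blocks (x ∷ [])     (y ∷ v) = descOK-one-block (y ∷ v)
  descOK-two-blocks (x ∷ y ∷ u) v       =
    trans (cong ((y <ᵇ x) ∧_) (descOK-two-blocks (y ∷ u) v)) (sym (∧-assoc (y <ᵇ x) (below y u) (decreasing v)))

  noFix-one-block : ∀ i v → noFixFirstTwo i (replicate (length v) 1 ++ []) v ≡ fixedFree i v
  noFix-one-block i []      = refl
  noFix-one-block i (x ∷ v) = cong (not (x ≡ᵇ i) ∧_) (noFix-one-block (suc i) v)

  noFix-two-blocks : ∀ i u v →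
    noFixFirstTwo i (replicate (length u) 0 ++ (replicate (length v) 1 ++ [])) (u ++ v)
    ≡ fixedFree i u ∧ fixedFree (i + length u) v
  noFix-two-blocks i []      v = trans (noFix-one-block i v) (cong (λ n → fixedFree n v) (sym (+-identityʳ i)))
  noFix-two-blocks i (x ∷ u) v =
    trans (cong (not (x ≡ᵇ i) ∧_) (noFix-two-blocks (suc i) u v))
          (trans (sym (∧-assoc (not (x ≡ᵇ i)) (fixedFree (suc i) u) _))
                 (cong (λ n → (not (x ≡ᵇ i) ∧ fixedFree (suc i) u) ∧ fixedFree n v) (sym (+-suc i (length u)))))

  -- Decreasing words have distinct letters, so distinctness of u ++ v only asks u, v to be disjoint.
  below-avoids : ∀ y w x → below y w ≡ true → y ≤ x → elemᵇ x w ≡ false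
  below-avoids y []      x _ _ = refl
  below-avoids y (z ∷ w) x below-yw y≤x with z <ᵇ y in z<ᵇy
  ... | true = cong₂ _∨_ (≡ᵇ-false (>⇒≢ z<x)) (below-avoids z w x below-yw (<⇒≤ z<x))
    where
    z<x : z < x
    z<x = <-≤-trans (<ᵇ⇒< z y (Equivalence.from T-≡ z<ᵇy)) y≤x

  below⇒decreasing : ∀ x w → below x w ≡ true → decreasing w ≡ true
  below⇒decreasing x []      _ = refl
  below⇒decreasing x (z ∷ w) below-xw with z <ᵇ x
  ... | true = below-xw

  decreasing⇒distinct : ∀ u → decreasing u ≡ true → distinct u ≡ true
  decreasing⇒distinct []      _     = refl
  decreasing⇒distinct (x ∷ w) dec-u =
    cong₂ (λ a b → not a ∧ b) (below-avoids x w x dec-u ≤-refl) (decreasing⇒distinct w (below⇒decreasing x w dec-u))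

  weight : ℕ → ℕ → List ℕ → ℕ
  weight a b w = 𝟙 (distinct w) * (𝟙 (descOK (labels (a ∷ b ∷ 0 ∷ 0 ∷ [])) w)
                                    * 𝟙 (noFixFirstTwo 1 (labels (a ∷ b ∷ 0 ∷ 0 ∷ [])) w))

  weight-arith : ∀ du dv dj f {du′ dv′} → (du ≡ true → du′ ≡ true) → (dv ≡ true → dv′ ≡ true) →
    𝟙 ((du′ ∧ dj) ∧ dv′) * (𝟙 (du ∧ dv) * 𝟙 f) ≡ 𝟙 du * (𝟙 dv * (𝟙 dj * 𝟙 f))
  weight-arith false dv    dj f {du′} {dv′} _ _ = *-zeroʳ (𝟙 ((du′ ∧ dj) ∧ dv′))
  weight-arith true  false dj f {du′} {dv′} _ _ = *-zeroʳ (𝟙 ((du′ ∧ dj) ∧ dv′))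
  weight-arith true  true  dj f du⇒du′ dv⇒dv′ rewrite du⇒du′ refl | dv⇒dv′ refl = both-decreasing dj f
    where
    both-decreasing : ∀ dj f → 𝟙 (dj ∧ true) * (1 * 𝟙 f) ≡ 1 * (1 * (𝟙 dj * 𝟙 f))
    both-decreasing true  true  = refl
    both-decreasing true  false = refl
    both-decreasing false f     = refl

  weight-split : ∀ u v {a b} → length u ≡ a → length v ≡ b →
    weight a b (u ++ v) ≡ 𝟙 (decreasing u) * (𝟙 (decreasing v) * (𝟙 (disjoint u v) * noFixed 1 (suc a) u v))
  weight-split u v refl refl =
    trans (cong₂ (λ d o → 𝟙 d * (𝟙 o * 𝟙 (noFixFirstTwo 1 (replicate (length u) 0 ++ (replicate (length v) 1 ++ [])) (u ++ v))))
                 (distinct-++ u v) (descOK-two-blocks u v))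
    (trans (cong (λ f → 𝟙 ((distinct u ∧ disjoint u v) ∧ distinct v) * (𝟙 (decreasing u ∧ decreasing v) * 𝟙 f))
                 (noFix-two-blocks 1 u v))
           (weight-arith (decreasing u) (decreasing v) (disjoint u v) _ (decreasing⇒distinct u) (decreasing⇒distinct v)))

  countNoFix-pairSum : ∀ a b → countNoFix (a ∷ b ∷ 0 ∷ 0 ∷ []) ≡ pairSum (a + b) a b (noFixed 1 (suc a))
  countNoFix-pairSum a b = begin
    countNoFix c
      ≡⟨ length-filter (noFixFirstTwo 1 (labels c)) (Sc c) ⟩
    ∑ (Sc c) (λ w → 𝟙 (noFixFirstTwo 1 (labels c) w))
      ≡⟨ ∑-filter (descOK (labels c)) (perms (a + (b + 0))) _ ⟩
    ∑ (perms (a + (b + 0))) (λ w → 𝟙 (descOK (labels c) w) * 𝟙 (noFixFirstTwo 1 (labels c) w))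
      ≡⟨ ∑-filter distinct (words (a + (b + 0)) (a + (b + 0))) _ ⟩
    ∑ (words (a + (b + 0)) (a + (b + 0))) (weight a b)
      ≡⟨ ∑-words (a + (b + 0)) (a + (b + 0)) (weight a b) ⟩
    ∑W (a + (b + 0)) (a + (b + 0)) (weight a b)
      ≡⟨ cong (λ n → ∑W (a + n) (a + n) (weight a b)) (+-identityʳ b) ⟩
    ∑W (a + b) (a + b) (weight a b)
      ≡⟨ ∑W-split (a + b) a b (weight a b) ⟩
    ∑W (a + b) a (λ u → ∑W (a + b) b (λ v → weight a b (u ++ v)))
      ≡⟨ ∑W-cong (a + b) a (λ u _ |u| → inner u |u|) ⟩
    ∑W (a + b) a (λ u → 𝟙 (decreasing u) * decSum (a + b) b (λ v → 𝟙 (disjoint u v) * noFixed 1 (suc a) u v))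
      ≡⟨ ∑W-decreasing (a + b) a _ ⟩
    pairSum (a + b) a b (noFixed 1 (suc a)) ∎
    where
    open ≡-Reasoning
    c = a ∷ b ∷ 0 ∷ 0 ∷ []
    inner : ∀ u → length u ≡ a →
      ∑W (a + b) b (λ v → weight a b (u ++ v))
      ≡ 𝟙 (decreasing u) * decSum (a + b) b (λ v → 𝟙 (disjoint u v) * noFixed 1 (suc a) u v)
    inner u |u| = begin
      ∑W (a + b) b (λ v → weight a b (u ++ v))
        ≡⟨ ∑W-cong (a + b) b (λ v _ |v| → weight-split u v |u| |v|) ⟩
      ∑W (a + b) b (λ v → 𝟙 (decreasing u) * (𝟙 (decreasing v) * (𝟙 (disjoint u v) * noFixed 1 (suc a) u v)))
        ≡⟨ ∑W-scale (a + b) b (𝟙 (decreasing u)) _ ⟩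
      𝟙 (decreasing u) * ∑W (a + b) b (λ v → 𝟙 (decreasing v) * (𝟙 (disjoint u v) * noFixed 1 (suc a) u v))
        ≡⟨ cong (𝟙 (decreasing u) *_) (∑W-decreasing (a + b) b _) ⟩
      𝟙 (decreasing u) * decSum (a + b) b (λ v → 𝟙 (disjoint u v) * noFixed 1 (suc a) u v) ∎

  G-derangements : ∀ a b → G a b 0 ≡ derangements a b
  G-derangements a b = begin
    G a b 0                                   ≡⟨ sum-upTo-first _ a (λ _ → refl) ⟩
    countNoFix (a ∷ b ∷ 0 ∷ 0 ∷ [])           ≡⟨ countNoFix-pairSum a b ⟩
    pairSum (a + b) a b (noFixed 1 (suc a))   ≡⟨ bridge (a + b) a b 1 (suc a) refl ⟩
    derangements a b                          ∎
    where open ≡-Reasoning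

  -- Deleting a fixed point of block 1.  Let block 1 (no fixed point yet, m₁+1 free slots from i₁ on)
  -- lie to the left of block 2.  Deleting the fixed point p and lowering every larger value by one
  -- (which moves block 2 one position to the left) matches the placements in which block 1 acquires a
  -- fixed point with the placements of one value less, block 1 shortened by one slot, and no fixed point
  -- in block 1.  The bounds 1 ≤ i₁ ≤ N say that a fixed point is possible at all.
  removal₁ : ∀ m₁ m₂ i₁ i₂ s₂ e₂ → 1 ≤ i₁ → i₁ ≤ suc (m₁ + m₂) → i₁ + m₁ ≤ i₂ →
    fixCount (suc m₁) m₂ i₁ (suc i₂) false s₂ true e₂ ≡ fixCount m₁ m₂ i₁ i₂ false s₂ false e₂
  -- The largest value N is the fixed point (i₁ = N).  Then block 1 is settled, the rest of it can
  -- never be fixed, and all of block 2 lies beyond the remaining values; if instead N goes to block 2,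
  -- block 1 can no longer acquire a fixed point.
  removal₁-top : ∀ m₁ m₂ i₂ s₂ e₂ → suc (m₁ + m₂) + m₁ ≤ i₂ →
    fixCount (suc m₁) m₂ (suc (m₁ + m₂)) (suc i₂) false s₂ true e₂ ≡ fixCount m₁ m₂ (suc (m₁ + m₂)) i₂ false s₂ false e₂
  removal₁-top-place₂ : ∀ m₁ m₂ i₂ s₂ e₂ → place₂ (suc m₁) m₂ (suc (m₁ + m₂)) (suc i₂) false s₂ true e₂ ≡ 0
  removal₁-place₁ : ∀ m₁ m₂ i₁ i₂ s₂ e₂ → i₁ ≤ m₁ + m₂ → i₁ + m₁ ≤ i₂ →
    place₁ (suc m₁) m₂ i₁ (suc i₂) false s₂ true e₂ ≡ place₁ m₁ m₂ i₁ i₂ false s₂ false e₂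
  removal₁-place₂ : ∀ m₁ m₂ i₁ i₂ s₂ e₂ → 1 ≤ i₁ → i₁ ≤ m₁ + m₂ → i₁ + m₁ ≤ i₂ →
    place₂ (suc m₁) m₂ i₁ (suc i₂) false s₂ true e₂ ≡ place₂ m₁ m₂ i₁ i₂ false s₂ false e₂

  removal₁ m₁ m₂ i₁ i₂ s₂ e₂ 1≤i₁ i₁≤v gap with m≤n⇒m<n∨m≡n i₁≤v
  ... | inj₂ refl = removal₁-top m₁ m₂ i₂ s₂ e₂ gap
  ... | inj₁ i₁<v =
    cong₂ _+_ (sym (finish-vanishes m₁ m₂ i₁ i₂ false s₂ false e₂ (≤-trans 1≤i₁ (≤-pred i₁<v))))
      (cong₂ _+_ (removal₁-place₁ m₁ m₂ i₁ i₂ s₂ e₂ (≤-pred i₁<v) gap)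
                 (removal₁-place₂ m₁ m₂ i₁ i₂ s₂ e₂ 1≤i₁ (≤-pred i₁<v) gap))

  removal₁-top m₁ m₂ i₂ s₂ e₂ gap = begin
    fixCount (suc m₁) m₂ v (suc i₂) false s₂ true e₂
      ≡⟨ cong₂ _+_ (cong (λ s → fixCount m₁ m₂ (suc v) (suc i₂) s s₂ true e₂) (mark-hit false v))
                   (removal₁-top-place₂ m₁ m₂ i₂ s₂ e₂) ⟩
    fixCount m₁ m₂ (suc v) (suc i₂) true s₂ true e₂ + 0
      ≡⟨ +-identityʳ _ ⟩
    fixCount m₁ m₂ (suc v) (suc i₂) true s₂ true e₂
      ≡⟨ relocate₁ m₁ m₂ (suc i₂) s₂ e₂ (suc v) v true false true false settled (passed (n<1+n _)) refl ⟩
    fixCount m₁ m₂ v (suc i₂) false s₂ false e₂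
      ≡⟨ relocate₂ m₁ m₂ v false false (suc i₂) i₂ s₂ s₂ e₂ e₂
                   (passed (m<n⇒m<1+n m₂+m₁<i₂)) (passed m₂+m₁<i₂) refl ⟩
    fixCount m₁ m₂ v i₂ false s₂ false e₂ ∎
    where
    open ≡-Reasoning
    v = suc (m₁ + m₂)
    m₂+m₁<i₂ : m₂ + m₁ < i₂
    m₂+m₁<i₂ = <-≤-trans (subst (_< v) (+-comm m₁ m₂) (n<1+n _)) (≤-trans (m≤m+n v m₁) gap)

  removal₁-top-place₂ m₁ zero      i₂ s₂ e₂ = refl
  removal₁-top-place₂ m₁ (suc m₂) i₂ s₂ e₂ =
    frozen₁ (suc m₁) m₂ (suc (m₁ + suc m₂)) 0 (suc (suc i₂)) false _ true e₂
            (passed (s<s (+-monoʳ-< m₁ (n<1+n m₂))))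

  removal₁-place₁ zero m₂ i₁ i₂ s₂ e₂ i₁≤m₂ gap =
    trans (cong (λ s → fixCount zero m₂ (suc i₁) (suc i₂) s s₂ true e₂) (mark-miss false (>⇒≢ (s≤s i₁≤m₂))))
          (frozen₁ zero m₂ (suc i₁) 0 (suc i₂) false s₂ true e₂ full)
  removal₁-place₁ (suc m₁) m₂ i₁ i₂ s₂ e₂ i₁≤v gap
    rewrite mark-miss false (>⇒≢ (s≤s i₁≤v)) with m≤n⇒m<n∨m≡n i₁≤v
  ... | inj₂ refl =
    trans (frozen₁ (suc m₁) m₂ (suc (suc (m₁ + m₂))) 0 (suc i₂) false s₂ true e₂ (passed ≤-refl))
          (sym (trans (cong (λ s → fixCount m₁ m₂ (suc (suc (m₁ + m₂))) i₂ s s₂ false e₂) (mark-hit false (suc (m₁ + m₂))))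
                      (frozen₁ m₁ m₂ (suc (suc (m₁ + m₂))) 0 i₂ true s₂ false e₂ settled)))
  ... | inj₁ i₁<v =
    trans (removal₁ m₁ m₂ (suc i₁) i₂ s₂ e₂ (s≤s z≤n) i₁<v (subst (_≤ i₂) (+-suc i₁ m₁) gap))
          (cong (λ s → fixCount m₁ m₂ (suc i₁) i₂ s s₂ false e₂) (sym (mark-miss false (>⇒≢ i₁<v))))

  removal₁-place₂ m₁ zero      i₁ i₂ s₂ e₂ _ _ _ = refl
  removal₁-place₂ m₁ (suc m₂) i₁ i₂ s₂ e₂ 1≤i₁ i₁≤m gap =
    removal₁ m₁ m₂ i₁ (suc i₂) _ e₂ 1≤i₁ (subst (i₁ ≤_) (+-suc m₁ m₂) i₁≤m) (m≤n⇒m≤1+n gap)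

  -- Deleting a fixed point of block 2, which comes last: its positions do not move.  The hypotheses are
  -- those of `removal₁` for block 2.
  removal₂ : ∀ m₁ m₂ i₁ i₂ s₁ e₁ → 1 ≤ i₂ → i₂ ≤ suc (m₁ + m₂) → i₁ + m₁ ≤ i₂ →
    fixCount m₁ (suc m₂) i₁ i₂ s₁ false e₁ true ≡ fixCount m₁ m₂ i₁ i₂ s₁ false e₁ false
  -- The largest value N is the fixed point (i₂ = N); if it goes to block 1 instead, block 2 is passed.
  removal₂-top : ∀ m₁ m₂ i₁ s₁ e₁ →
    fixCount m₁ (suc m₂) i₁ (suc (m₁ + m₂)) s₁ false e₁ true ≡ fixCount m₁ m₂ i₁ (suc (m₁ + m₂)) s₁ false e₁ false
  removal₂-top-place₁ : ∀ m₁ m₂ i₁ s₁ e₁ → place₁ m₁ (suc m₂) i₁ (suc (m₁ + m₂)) s₁ false e₁ true ≡ 0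
  removal₂-place₁ : ∀ m₁ m₂ i₁ i₂ s₁ e₁ → 1 ≤ i₂ → i₂ ≤ m₁ + m₂ → i₁ + m₁ ≤ i₂ →
    place₁ m₁ (suc m₂) i₁ i₂ s₁ false e₁ true ≡ place₁ m₁ m₂ i₁ i₂ s₁ false e₁ false
  removal₂-place₂ : ∀ m₁ m₂ i₁ i₂ s₁ e₁ → i₂ ≤ m₁ + m₂ → i₁ + m₁ ≤ i₂ →
    place₂ m₁ (suc m₂) i₁ i₂ s₁ false e₁ true ≡ place₂ m₁ m₂ i₁ i₂ s₁ false e₁ false

  removal₂ m₁ m₂ i₁ i₂ s₁ e₁ 1≤i₂ i₂≤v gap with m≤n⇒m<n∨m≡n i₂≤v
  ... | inj₂ refl = removal₂-top m₁ m₂ i₁ s₁ e₁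
  ... | inj₁ i₂<v =
    cong₂ _+_ (trans (finish-vanishes m₁ (suc m₂) i₁ i₂ s₁ false e₁ true (subst (0 <_) (sym (+-suc m₁ m₂)) z<s))
                     (sym (finish-vanishes m₁ m₂ i₁ i₂ s₁ false e₁ false (≤-trans 1≤i₂ (≤-pred i₂<v)))))
      (cong₂ _+_ (removal₂-place₁ m₁ m₂ i₁ i₂ s₁ e₁ 1≤i₂ (≤-pred i₂<v) gap)
                 (removal₂-place₂ m₁ m₂ i₁ i₂ s₁ e₁ (≤-pred i₂<v) gap))

  removal₂-top m₁ m₂ i₁ s₁ e₁ = begin
    fixCount m₁ (suc m₂) i₁ v s₁ false e₁ true
      ≡⟨ cong₂ _+_ (finish-vanishes m₁ (suc m₂) i₁ v s₁ false e₁ true (subst (0 <_) (sym (+-suc m₁ m₂)) z<s))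
           (cong₂ _+_ (removal₂-top-place₁ m₁ m₂ i₁ s₁ e₁)
                      (cong (λ s → fixCount m₁ m₂ i₁ (suc v) s₁ s e₁ true) (mark-hit false v))) ⟩
    fixCount m₁ m₂ i₁ (suc v) s₁ true e₁ true
      ≡⟨ relocate₂ m₁ m₂ i₁ s₁ e₁ (suc v) v true false true false
                   settled (passed (subst (_< v) (+-comm m₁ m₂) (n<1+n _))) refl ⟩
    fixCount m₁ m₂ i₁ v s₁ false e₁ false ∎
    where
    open ≡-Reasoning
    v = suc (m₁ + m₂)

  removal₂-top-place₁ zero      m₂ i₁ s₁ e₁ = refl
  removal₂-top-place₁ (suc m₁) m₂ i₁ s₁ e₁ =
    frozen₂ m₁ (suc m₂) (suc i₁) (suc (suc (m₁ + m₂))) 0 _ false e₁ true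
            (passed (s<s (subst (_< suc (m₁ + m₂)) (+-comm m₁ m₂) (n<1+n _))))

  removal₂-place₁ zero      m₂ i₁ i₂ s₁ e₁ _ _ _ = refl
  removal₂-place₁ (suc m₁) m₂ i₁ i₂ s₁ e₁ 1≤i₂ i₂≤m gap = begin
    fixCount m₁ (suc m₂) (suc i₁) i₂ (mark s₁ (suc (m₁ + suc m₂)) i₁) false e₁ true
      ≡⟨ cong (λ s → fixCount m₁ (suc m₂) (suc i₁) i₂ s false e₁ true)
              (mark-miss s₁ (>⇒≢ (<-trans i₁<v (s<s (+-monoʳ-< m₁ (n<1+n m₂)))))) ⟩
    fixCount m₁ (suc m₂) (suc i₁) i₂ s₁ false e₁ true
      ≡⟨ removal₂ m₁ m₂ (suc i₁) i₂ s₁ e₁ 1≤i₂ i₂≤m (subst (_≤ i₂) (+-suc i₁ m₁) gap) ⟩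
    fixCount m₁ m₂ (suc i₁) i₂ s₁ false e₁ false
      ≡⟨ cong (λ s → fixCount m₁ m₂ (suc i₁) i₂ s false e₁ false) (sym (mark-miss s₁ (>⇒≢ i₁<v))) ⟩
    fixCount m₁ m₂ (suc i₁) i₂ (mark s₁ (suc (m₁ + m₂)) i₁) false e₁ false ∎
    where
    open ≡-Reasoning
    -- block 1 lies before block 2, so its positions stay below the values still to be placed
    i₁≤m₂ : i₁ ≤ m₂
    i₁≤m₂ = +-cancelʳ-≤ (suc m₁) i₁ m₂ (≤-trans gap (subst (i₂ ≤_) (+-comm (suc m₁) m₂) i₂≤m))
    i₁<v : i₁ < suc (m₁ + m₂)
    i₁<v = s≤s (≤-trans i₁≤m₂ (m≤n+m m₂ m₁))

  removal₂-place₂ m₁ zero i₁ i₂ s₁ e₁ i₂≤m gap =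
    trans (cong (λ s → fixCount m₁ zero i₁ (suc i₂) s₁ s e₁ true) (mark-miss false (>⇒≢ (s≤s i₂≤m))))
          (frozen₂ m₁ zero i₁ (suc i₂) 0 s₁ false e₁ true full)
  removal₂-place₂ m₁ (suc m₂) i₁ i₂ s₁ e₁ i₂≤m gap
    rewrite mark-miss false (>⇒≢ (s≤s i₂≤m)) with m≤n⇒m<n∨m≡n (subst (i₂ ≤_) (+-suc m₁ m₂) i₂≤m)
  ... | inj₂ refl =
    trans (frozen₂ m₁ (suc m₂) i₁ (suc (suc (m₁ + m₂))) 0 s₁ false e₁ true
                   (passed (s<s (subst (_< suc (m₁ + m₂)) (+-comm m₁ m₂) (n<1+n _)))))
          (sym (trans (cong (λ s → fixCount m₁ m₂ i₁ (suc (suc (m₁ + m₂))) s₁ s e₁ false) (mark-hit false (suc (m₁ + m₂))))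
                      (frozen₂ m₁ m₂ i₁ (suc (suc (m₁ + m₂))) 0 s₁ true e₁ false settled)))
  ... | inj₁ i₂<v =
    trans (removal₂ m₁ m₂ i₁ (suc i₂) s₁ e₁ (s≤s z≤n) i₂<v (m≤n⇒m≤1+n gap))
          (cong (λ s → fixCount m₁ m₂ i₁ (suc i₂) s₁ s e₁ false) (sym (mark-miss false (>⇒≢ i₂<v))))

  Σflags : Counter → (m₁ m₂ i₁ i₂ : ℕ) (s₁ s₂ : Bool) → ℕ
  Σflags C m₁ m₂ i₁ i₂ s₁ s₂ =
    C m₁ m₂ i₁ i₂ s₁ s₂ true true + C m₁ m₂ i₁ i₂ s₁ s₂ true false
    + C m₁ m₂ i₁ i₂ s₁ s₂ false true + C m₁ m₂ i₁ i₂ s₁ s₂ false false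

  regroup-flags : ∀ a₁ b₁ c₁ a₂ b₂ c₂ a₃ b₃ c₃ a₄ b₄ c₄ →
    (a₁ + (b₁ + c₁)) + (a₂ + (b₂ + c₂)) + (a₃ + (b₃ + c₃)) + (a₄ + (b₄ + c₄))
    ≡ (a₁ + a₂ + a₃ + a₄) + ((b₁ + b₂ + b₃ + b₄) + (c₁ + c₂ + c₃ + c₄))
  regroup-flags = solve-∀

  -- Every placement ends with some flags, so summing over them counts all placements; with all flags set
  -- and expected, the flags impose nothing.
  flagSum : ∀ m₁ m₂ i₁ i₂ s₁ s₂ → Σflags fixCount m₁ m₂ i₁ i₂ s₁ s₂ ≡ fixCount m₁ m₂ i₁ i₂ true true true true
  flagSum-finish : ∀ m₁ m₂ i₁ i₂ s₁ s₂ → Σflags finish m₁ m₂ i₁ i₂ s₁ s₂ ≡ finish m₁ m₂ i₁ i₂ true true true true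
  flagSum-place₁ : ∀ m₁ m₂ i₁ i₂ s₁ s₂ → Σflags place₁ m₁ m₂ i₁ i₂ s₁ s₂ ≡ place₁ m₁ m₂ i₁ i₂ true true true true
  flagSum-place₂ : ∀ m₁ m₂ i₁ i₂ s₁ s₂ → Σflags place₂ m₁ m₂ i₁ i₂ s₁ s₂ ≡ place₂ m₁ m₂ i₁ i₂ true true true true

  flagSum m₁ m₂ i₁ i₂ s₁ s₂ =
    trans (regroup-flags (f true true) (p₁ true true) (p₂ true true) (f true false) (p₁ true false) (p₂ true false)
                       (f false true) (p₁ false true) (p₂ false true) (f false false) (p₁ false false) (p₂ false false))
          (cong₂ _+_ (flagSum-finish m₁ m₂ i₁ i₂ s₁ s₂)
                     (cong₂ _+_ (flagSum-place₁ m₁ m₂ i₁ i₂ s₁ s₂) (flagSum-place₂ m₁ m₂ i₁ i₂ s₁ s₂)))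
    where
    f p₁ p₂ : Bool → Bool → ℕ
    f  e₁ e₂ = finish m₁ m₂ i₁ i₂ s₁ s₂ e₁ e₂
    p₁ e₁ e₂ = place₁ m₁ m₂ i₁ i₂ s₁ s₂ e₁ e₂
    p₂ e₁ e₂ = place₂ m₁ m₂ i₁ i₂ s₁ s₂ e₁ e₂

  flagSum-finish zero    zero    _ _ true  true  = refl
  flagSum-finish zero    zero    _ _ true  false = refl
  flagSum-finish zero    zero    _ _ false true  = refl
  flagSum-finish zero    zero    _ _ false false = refl
  flagSum-finish (suc _) _       _ _ _     _     = refl
  flagSum-finish zero    (suc _) _ _ _     _     = refl

  flagSum-place₁ zero      _  _  _  _  _  = refl
  flagSum-place₁ (suc m₁) m₂ i₁ i₂ s₁ s₂ = flagSum m₁ m₂ (suc i₁) i₂ _ s₂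

  flagSum-place₂ _  zero      _  _  _  _  = refl
  flagSum-place₂ m₁ (suc m₂) i₁ i₂ s₁ s₂ = flagSum m₁ m₂ i₁ (suc i₂) s₁ _

  -- All placements of m₁ + m₂ values into blocks of m₁ and m₂ slots, i.e. the binomial coefficient
  -- (m₁+m₂ choose m₁); only its Pascal recursion and boundary values are needed.
  arrangements : ℕ → ℕ → ℕ
  arrangements m₁ m₂ = fixCount m₁ m₂ 0 0 true true true true

  arrangements-anywhere : ∀ m₁ m₂ i₁ i₂ → fixCount m₁ m₂ i₁ i₂ true true true true ≡ arrangements m₁ m₂
  arrangements-anywhere m₁ m₂ i₁ i₂ =
    trans (relocate₁ m₁ m₂ i₂ true true i₁ 0 true true true true settled settled refl)
          (relocate₂ m₁ m₂ 0 true true i₂ 0 true true true true settled settled refl)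

  arrangements-pascal : ∀ m₁ m₂ → arrangements (suc m₁) (suc m₂) ≡ arrangements m₁ (suc m₂) + arrangements (suc m₁) m₂
  arrangements-pascal m₁ m₂ =
    cong₂ _+_ (arrangements-anywhere m₁ (suc m₂) 1 0) (arrangements-anywhere (suc m₁) m₂ 0 1)

  arrangements-edge₁ : ∀ m → arrangements 0 m ≡ 1
  arrangements-edge₁ zero    = refl
  arrangements-edge₁ (suc m) = trans (arrangements-anywhere 0 m 0 1) (arrangements-edge₁ m)

  arrangements-edge₂ : ∀ m → arrangements m 0 ≡ 1
  arrangements-edge₂ zero    = refl
  arrangements-edge₂ (suc m) =
    trans (+-identityʳ _) (trans (arrangements-anywhere m 0 1 0) (arrangements-edge₂ m))

  D : ℕ → ℕ → ℕ
  D zero     _        = 0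
  D (suc _)  zero     = 0
  D (suc m₁) (suc m₂) = derangements m₁ m₂

  D-axis₂ : ∀ m₁ → D m₁ 0 ≡ 0
  D-axis₂ zero    = refl
  D-axis₂ (suc _) = refl

  fixed-in-first : ∀ m₁ m₂ → fixCount m₁ m₂ 1 (suc m₁) false false true false ≡ D m₁ (suc m₂)
  fixed-in-first zero     m₂ = frozen₁ zero m₂ 1 0 1 false false true false full
  fixed-in-first (suc m₁) m₂ = removal₁ m₁ m₂ 1 (suc m₁) false false ≤-refl (s≤s z≤n) ≤-refl

  fixed-in-second : ∀ m₁ m₂ → fixCount m₁ m₂ 1 (suc m₁) false false false true ≡ D (suc m₁) m₂
  fixed-in-second m₁ zero     = frozen₂ m₁ zero 1 (suc m₁) 0 false false false true full
  fixed-in-second m₁ (suc m₂) = removal₂ m₁ m₂ 1 (suc m₁) false false (s≤s z≤n) (s≤s (m≤m+n m₁ m₂)) ≤-refl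

  fixed-in-both : ∀ m₁ m₂ → fixCount m₁ m₂ 1 (suc m₁) false false true true ≡ D m₁ m₂
  fixed-in-both zero     m₂ = frozen₁ zero m₂ 1 0 1 false false true true full
  fixed-in-both (suc m₁) m₂ =
    trans (removal₁ m₁ m₂ 1 (suc m₁) false true ≤-refl (s≤s z≤n) ≤-refl) (fixed-in-second m₁ m₂)

  -- Sorting the (i+j choose i) placements by the blocks that contain a fixed point:
  -- D i j + D i (j+1) + D (i+1) j + D (i+1) (j+1) = (i+j choose i).
  four-classes : ∀ m₁ m₂ → D m₁ m₂ + D m₁ (suc m₂) + D (suc m₁) m₂ + D (suc m₁) (suc m₂) ≡ arrangements m₁ m₂
  four-classes m₁ m₂ = begin
    D m₁ m₂ + D m₁ (suc m₂) + D (suc m₁) m₂ + D (suc m₁) (suc m₂)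
      ≡⟨ cong₂ _+_ (cong₂ _+_ (cong₂ _+_ (fixed-in-both m₁ m₂) (fixed-in-first m₁ m₂)) (fixed-in-second m₁ m₂)) refl ⟨
    Σflags fixCount m₁ m₂ 1 (suc m₁) false false
      ≡⟨ flagSum m₁ m₂ 1 (suc m₁) false false ⟩
    fixCount m₁ m₂ 1 (suc m₁) true true true true
      ≡⟨ arrangements-anywhere m₁ m₂ 1 (suc m₁) ⟩
    arrangements m₁ m₂ ∎
    where open ≡-Reasoning

module AlternatingRecurrence where

  open import Data.Integer using (ℤ; +_; _+_; _-_; -_; -1ℤ; 1ℤ; _^_)
  import Data.Integer.Properties as ℤ
  open import Data.Integer.Tactic.RingSolver using (solve-∀)
  open import Data.Nat as ℕ using (ℕ; zero; suc)
  import Data.Nat.Properties as ℕ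
  open import Relation.Binary.PropositionalEquality

  σ : ℕ → ℤ
  σ n = -1ℤ ^ n

  σ-suc : ∀ n → σ (suc n) ≡ - σ n
  σ-suc n = ℤ.-1*i≡-i (σ n)

  σ-+suc : ∀ m n → σ (m ℕ.+ suc n) ≡ - σ (m ℕ.+ n)
  σ-+suc m n = trans (cong σ (ℕ.+-suc m n)) (σ-suc (m ℕ.+ n))

  σ-suc-+suc : ∀ m n → σ (suc m ℕ.+ suc n) ≡ σ (m ℕ.+ n)
  σ-suc-+suc m n = trans (σ-suc (m ℕ.+ suc n)) (trans (cong -_ (σ-+suc m n)) (ℤ.neg-involutive _))

  cancel-left : ∀ a x c → a + x ≡ c → x ≡ c - a
  cancel-left a x c a+x≡c = trans (x≡a+x-a a x) (cong (_- a) a+x≡c)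
    where
    x≡a+x-a : ∀ a x → x ≡ (a + x) - a
    x≡a+x-a = solve-∀

  alternating : (y : ℕ → ℕ) → y 0 ≡ 0 → (∀ n → y n ℕ.+ y (suc n) ≡ 1) → ∀ n → + y (suc n) ≡ + y n + σ n
  alternating y y₀ step n = begin
    + y (suc n)                        ≡⟨ next n ⟩
    1ℤ - + y n                         ≡⟨ halve (+ y n) ⟩
    + y n + (1ℤ - (+ y n + + y n))     ≡⟨ cong (λ z → + y n + z) (sign n) ⟨
    + y n + σ n                        ∎
    where
    open ≡-Reasoning
    halve : ∀ x → 1ℤ - x ≡ x + (1ℤ - (x + x))
    halve = solve-∀
    next : ∀ n → + y (suc n) ≡ 1ℤ - + y n
    next n = cancel-left (+ y n) (+ y (suc n)) 1ℤ (cong +_ (step n))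
    sign : ∀ n → σ n ≡ 1ℤ - (+ y n + + y n)
    sign zero    rewrite y₀ = refl
    sign (suc n) = begin
      σ (suc n)                          ≡⟨ σ-suc n ⟩
      - σ n                              ≡⟨ cong -_ (sign n) ⟩
      - (1ℤ - (+ y n + + y n))           ≡⟨ flip (+ y n) ⟩
      1ℤ - ((1ℤ - + y n) + (1ℤ - + y n)) ≡⟨ cong (λ z → 1ℤ - (z + z)) (sym (next n)) ⟩
      1ℤ - (+ y (suc n) + + y (suc n))   ∎
      where
      flip : ∀ x → - (1ℤ - (x + x)) ≡ 1ℤ - ((1ℤ - x) + (1ℤ - x))
      flip = solve-∀

  -- With x_ab = H(i+a, j+b) and
  -- s = (-1)^(i+j), the block sums at (i+1,j+1), (i,j+1) and (i+1,j), the first one split by Pascal's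
  -- rule, and the recurrence at the three neighbouring points determine the corner x₂₂.
  square-step : ∀ (x₀₁ x₀₂ x₁₀ x₁₁ x₁₂ x₂₀ x₂₁ x₂₂ b₀₁ b₁₀ s : ℤ) →
    x₁₁ + x₁₂ + x₂₁ + x₂₂ ≡ b₀₁ + b₁₀ → x₀₁ + x₀₂ + x₁₁ + x₁₂ ≡ b₀₁ → x₁₀ + x₁₁ + x₂₀ + x₂₁ ≡ b₁₀ →
    x₁₂ ≡ x₀₂ + x₁₁ - s → x₂₁ ≡ x₁₁ + x₂₀ - s → x₁₁ ≡ x₀₁ + x₁₀ + s →
    x₂₂ ≡ x₁₂ + x₂₁ + s
  square-step x₀₁ x₀₂ x₁₀ _ _ x₂₀ _ x₂₂ _ _ s corner refl refl refl refl refl =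
    trans (cancel-left _ x₂₂ _ corner) (eliminate x₀₁ x₀₂ x₁₀ x₂₀ s)
    where
    eliminate : ∀ x₀₁ x₀₂ x₁₀ x₂₀ s →
      let x₁₁ = x₀₁ + x₁₀ + s ; x₁₂ = x₀₂ + x₁₁ - s ; x₂₁ = x₁₁ + x₂₀ - s in
      ((x₀₁ + x₀₂ + x₁₁ + x₁₂) + (x₁₀ + x₁₁ + x₂₀ + x₂₁)) - (x₁₁ + x₁₂ + x₂₁) ≡ x₁₂ + x₂₁ + s
    eliminate = solve-∀

  module BlockRecurrence
    (H B : ℕ → ℕ → ℕ)
    (H-axis₁ : ∀ j → H 0 j ≡ 0) (H-axis₂ : ∀ i → H i 0 ≡ 0)
    (B-edge₁ : ∀ j → B 0 j ≡ 1) (B-edge₂ : ∀ i → B i 0 ≡ 1)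
    (B-pascal : ∀ i j → B (suc i) (suc j) ≡ B i (suc j) ℕ.+ B (suc i) j)
    (blocks : ∀ i j → H i j ℕ.+ H i (suc j) ℕ.+ H (suc i) j ℕ.+ H (suc i) (suc j) ≡ B i j)
    where

    -- On the first row and column the block sums say that H alternates between 0 and 1.
    row : ∀ n → H 1 n ℕ.+ H 1 (suc n) ≡ 1
    row n = begin
      H 1 n ℕ.+ H 1 (suc n)                              ≡⟨ cong₂ (λ a b → a ℕ.+ b ℕ.+ H 1 n ℕ.+ H 1 (suc n)) (H-axis₁ n) (H-axis₁ (suc n)) ⟨
      H 0 n ℕ.+ H 0 (suc n) ℕ.+ H 1 n ℕ.+ H 1 (suc n)    ≡⟨ blocks 0 n ⟩
      B 0 n                                              ≡⟨ B-edge₁ n ⟩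
      1                                                  ∎
      where open ≡-Reasoning

    column : ∀ n → H n 1 ℕ.+ H (suc n) 1 ≡ 1
    column n = begin
      H n 1 ℕ.+ H (suc n) 1                              ≡⟨ cong (ℕ._+ H (suc n) 1) (ℕ.+-identityʳ (H n 1)) ⟨
      0 ℕ.+ H n 1 ℕ.+ 0 ℕ.+ H (suc n) 1                  ≡⟨ cong₂ (λ a b → a ℕ.+ H n 1 ℕ.+ b ℕ.+ H (suc n) 1) (H-axis₂ n) (H-axis₂ (suc n)) ⟨
      H n 0 ℕ.+ H n 1 ℕ.+ H (suc n) 0 ℕ.+ H (suc n) 1    ≡⟨ blocks n 0 ⟩
      B n 0                                              ≡⟨ B-edge₂ n ⟩
      1                                                  ∎
      where open ≡-Reasoning

    -- Induction over the grid: the axes by `alternating`, the interior by `square-step`.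
    recurrence : ∀ i j → + H (suc i) (suc j) ≡ + H i (suc j) + + H (suc i) j + σ (i ℕ.+ j)
    recurrence zero j =
      trans (alternating (H 1) (H-axis₂ 1) row j)
            (cong (λ h → + h + + H 1 j + σ j) (sym (H-axis₁ (suc j))))
    recurrence (suc i) zero = begin
      + H (suc (suc i)) 1                                  ≡⟨ alternating (λ n → H n 1) (H-axis₁ 1) column (suc i) ⟩
      + H (suc i) 1 + σ (suc i)                            ≡⟨ cong₂ (λ h n → h + σ (suc n)) (ℤ.+-identityʳ (+ H (suc i) 1)) (ℕ.+-identityʳ i) ⟨
      + H (suc i) 1 + + 0 + σ (suc i ℕ.+ 0)                ≡⟨ cong (λ h → + H (suc i) 1 + + h + σ (suc i ℕ.+ 0)) (H-axis₂ (suc (suc i))) ⟨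
      + H (suc i) 1 + + H (suc (suc i)) 0 + σ (suc i ℕ.+ 0) ∎
      where open ≡-Reasoning
    recurrence (suc i) (suc j) =
      trans (square-step (+ H i (suc j)) (+ H i (suc (suc j))) (+ H (suc i) j) (+ H (suc i) (suc j))
                         (+ H (suc i) (suc (suc j))) (+ H (suc (suc i)) j) (+ H (suc (suc i)) (suc j))
                         (+ H (suc (suc i)) (suc (suc j))) (+ B i (suc j)) (+ B (suc i) j) (σ (i ℕ.+ j))
                         (cong +_ (trans (blocks (suc i) (suc j)) (B-pascal i j)))
                         (cong +_ (blocks i (suc j)))
                         (cong +_ (blocks (suc i) j))
                         (trans (recurrence i (suc j)) (cong (λ z → + H i (suc (suc j)) + + H (suc i) (suc j) + z) (σ-+suc i j)))
                         (trans (recurrence (suc i) j) (cong (λ z → + H (suc i) (suc j) + + H (suc (suc i)) j + z) (σ-suc (i ℕ.+ j))))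
                         (recurrence i j))
            (cong (λ z → + H (suc i) (suc (suc j)) + + H (suc (suc i)) (suc j) + z) (sym (σ-suc-+suc i j)))

open Placements using (D; D-axis₂; arrangements; arrangements-edge₁; arrangements-edge₂; arrangements-pascal;
                     four-classes; derangements; G-derangements)
open AlternatingRecurrence using (module BlockRecurrence)

open import Data.Nat using (ℕ; zero; suc; _≤_; _∸_)
open import Data.Integer using (ℤ; +_; _+_; -_; -1ℤ)
open import Data.Integer using () renaming (_^_ to _^ℤ_)
open import Relation.Binary.PropositionalEquality using (_≡_; refl; cong; cong₂; module ≡-Reasoning)

open BlockRecurrence D arrangements (λ _ → refl) D-axis₂ arrangements-edge₁ arrangements-edge₂
                     arrangements-pascal four-classes

-- The theorem is the block recurrence for H = D, read through `G-derangements`.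
lemma7 : (a₁ a₂ : ℕ) → 1 ≤ a₁ → 1 ≤ a₂ →
    + G a₁ a₂ 0 ≡ + G (a₁ ∸ 1) a₂ 0 + + G a₁ (a₂ ∸ 1) 0 + -1ℤ ^ℤ (a₁ Data.Nat.+ a₂)
lemma7 zero    _       ()  _
lemma7 (suc _) zero    _   ()
lemma7 (suc i) (suc j) _   _ = begin
  + G (suc i) (suc j) 0                       ≡⟨ cong +_ (G-derangements (suc i) (suc j)) ⟩
  + derangements (suc i) (suc j)              ≡⟨ recurrence (suc i) (suc j) ⟩
  + derangements i (suc j) + + derangements (suc i) j + sign
    ≡⟨ cong₂ (λ x y → + x + + y + sign) (G-derangements i (suc j)) (G-derangements (suc i) j) ⟨
  + G i (suc j) 0 + + G (suc i) j 0 + sign    ∎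
  where
  open ≡-Reasoning
  sign = -1ℤ ^ℤ (suc i Data.Nat.+ suc j)
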